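{- Let $G$, $\mathrm{sh}_\gamma$ be as in the context, and define on $G$ the operations $g*h:=g\cdot\mathrm{sh}_1(h)\cdot\Sigma_\varepsilon\cdot\mathrm{sh}_1(g)^{ -1}$ and $g\circ h:=g\cdot\mathrm{sh}_1(h)\cdot A_\varepsilon$. Then for all $x,y,z\in G$ and $\square\in\{*,\circ\}$: $(x*y)\,\square\,(x*z)=(x*(y\,\square\,z))\cdot\Sigma_0$; $(x\circ y)*z=(x*(y*z))\cdot A_0$; $(x\cdot\mathrm{sh}_0(z))\,\square\,y=(x\,\square\,y)\cdot\mathrm{sh}_{00}(z)$; $x\,\square\,(y\cdot\mathrm{sh}_0(z))=(x\,\square\,y)\cdot\mathrm{sh}_{01}(z)$.
   Context: Addresses are finite words over $\{0,1\}$, $\varepsilon$ the empty address; $\alpha,\beta$ are incomparable if there is $\gamma$ with $\gamma0$ a prefix of $\alpha$ and $\gamma1$ a prefix of $\beta$, or vice versa. $G$ is the group generated by elements $\Sigma_\alpha, A_\alpha$ ($\alpha\in\{0,1\}^*$) subject to the following relations, where $X,Y$ range over $\{\Sigma,A\}$ and $\alpha,\delta$ over all addresses: (1) $X_\alpha Y_\beta=Y_\beta X_\alpha$ for $\alpha,\beta$ incomparable; (2) $X_{\alpha0\delta}\Sigma_\alpha=\Sigma_\alpha X_{\alpha00\delta}X_{\alpha10\delta}$; (3) $X_{\alpha10\delta}\Sigma_\alpha=\Sigma_\alpha X_{\alpha01\delta}$; (4) $X_{\alpha11\delta}\Sigma_\alpha=\Sigma_\alpha X_{\alpha11\delta}$;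 (5) $X_{\alpha0\delta}A_\alpha=A_\alpha X_{\alpha00\delta}$; (6) $X_{\alpha10\delta}A_\alpha=A_\alpha X_{\alpha01\delta}$; (7) $X_{\alpha11\delta}A_\alpha=A_\alpha X_{\alpha1\delta}$; (8) $\Sigma_\alpha\Sigma_{\alpha1}\Sigma_\alpha=\Sigma_{\alpha1}\Sigma_\alpha\Sigma_{\alpha1}\Sigma_{\alpha0}$; (9) $\Sigma_\alpha\Sigma_{\alpha1}A_\alpha=A_{\alpha1}\Sigma_\alpha\Sigma_{\alpha0}$; (10) $A_\alpha\Sigma_\alpha=\Sigma_{\alpha1}\Sigma_\alpha A_{\alpha1}A_{\alpha0}$. For an address $\gamma$, $\mathrm{sh}_\gamma$ is the endomorphism of $G$ with $\Sigma_\alpha\mapsto\Sigma_{\gamma\alpha}$, $A_\alpha\mapsto A_{\gamma\alpha}$. -}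

module Defs where

open import Data.Bool using (Bool; true; false)
open import Data.List using (List; []; _∷_; _++_)
open import Data.Product using (∃; ∃-syntax; _×_; _,_)
open import Data.Sum using (_⊎_)
open import Relation.Binary.PropositionalEquality using (_≡_)

-- Addresses: finite words over {0,1}; 0 = false, 1 = true.
Address : Set
Address = List Bool

ε : Address
ε = []

_·0_ : Address → Address → Address
α ·0 δ = α ++ false ∷ δ
_·1_ : Address → Address → Address
α ·1 δ = α ++ true ∷ δ
_·00_ _·01_ _·10_ _·11_ : Address → Address → Address
α ·00 δ = α ++ false ∷ false ∷ δ
α ·01 δ = α ++ false ∷ true ∷ δ
α ·10 δ = α ++ true ∷ false ∷ δ
α ·11 δ = α ++ true ∷ true ∷ δ

Incomparable : Address → Address → Set
Incomparable α β =
  (∃[ γ ] ∃[ δ ] ∃[ δ' ] (α ≡ γ ·0 δ × β ≡ γ ·1 δ'))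
  ⊎ (∃[ γ ] ∃[ δ ] ∃[ δ' ] (α ≡ γ ·1 δ × β ≡ γ ·0 δ'))

-- The two kinds of generators: Σ (here `S`) and A.
data Kind : Set where
  S A : Kind

infixl 7 _·_
infix 8 _⁻¹
data Term : Set where
  gen  : Kind → Address → Term
  one  : Term
  _·_  : Term → Term → Term
  _⁻¹  : Term → Term

Σ′ : Address → Term
Σ′ α = gen S α
A′ : Address → Term
A′ α = gen A α

-- Equality in G: the congruence generated by the group axioms and
-- the defining relations (1)–(10).  G = Term / _≈_.
infix 4 _≈_
data _≈_ : Term → Term → Set where
  ≈-refl  : ∀ {x} → x ≈ x
  ≈-sym   : ∀ {x y} → x ≈ y → y ≈ x
  ≈-trans : ∀ {x y z} → x ≈ y → y ≈ z → x ≈ z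
  ·-cong  : ∀ {x x' y y'} → x ≈ x' → y ≈ y' → x · y ≈ x' · y'
  ⁻¹-cong : ∀ {x x'} → x ≈ x' → x ⁻¹ ≈ x' ⁻¹
  assoc   : ∀ x y z → (x · y) · z ≈ x · (y · z)
  idˡ     : ∀ x → one · x ≈ x
  idʳ     : ∀ x → x · one ≈ x
  invˡ    : ∀ x → x ⁻¹ · x ≈ one
  invʳ    : ∀ x → x · x ⁻¹ ≈ one
  r1  : ∀ X Y α β → Incomparable α β → gen X α · gen Y β ≈ gen Y β · gen X α
  r2  : ∀ X α δ → gen X (α ·0 δ) · Σ′ α ≈ Σ′ α · gen X (α ·00 δ) · gen X (α ·10 δ)
  r3  : ∀ X α δ → gen X (α ·10 δ) · Σ′ α ≈ Σ′ α · gen X (α ·01 δ)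
  r4  : ∀ X α δ → gen X (α ·11 δ) · Σ′ α ≈ Σ′ α · gen X (α ·11 δ)
  r5  : ∀ X α δ → gen X (α ·0 δ) · A′ α ≈ A′ α · gen X (α ·00 δ)
  r6  : ∀ X α δ → gen X (α ·10 δ) · A′ α ≈ A′ α · gen X (α ·01 δ)
  r7  : ∀ X α δ → gen X (α ·11 δ) · A′ α ≈ A′ α · gen X (α ·1 δ)
  r8  : ∀ α → Σ′ α · Σ′ (α ·1 []) · Σ′ α ≈ Σ′ (α ·1 []) · Σ′ α · Σ′ (α ·1 []) · Σ′ (α ·0 [])
  r9  : ∀ α → Σ′ α · Σ′ (α ·1 []) · A′ α ≈ A′ (α ·1 []) · Σ′ α · Σ′ (α ·0 [])
  r10 : ∀ α → A′ α · Σ′ α ≈ Σ′ (α ·1 []) · Σ′ α · A′ (α ·1 []) · A′ (α ·0 [])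

sh : Address → Term → Term
sh γ (gen X α) = gen X (γ ++ α)
sh γ one       = one
sh γ (x · y)   = sh γ x · sh γ y
sh γ (x ⁻¹)    = (sh γ x) ⁻¹

infixl 6 _⋆_ _∘_
_⋆_ : Term → Term → Term
g ⋆ h = g · sh (true ∷ []) h · Σ′ ε · (sh (true ∷ []) g) ⁻¹
_∘_ : Term → Term → Term
g ∘ h = g · sh (true ∷ []) h · A′ ε

data Op : Set where
  star circ : Op

infixl 6 _⟨_⟩_
_⟨_⟩_ : Term → Op → Term → Term
x ⟨ star ⟩ y = x ⋆ y
x ⟨ circ ⟩ y = x ∘ y

{-# OPTIONS --safe #-}
-- Both sides of each identity expand into words in x, y, z, their shifts and the
-- generators at ε, 0 and 1, and the left word is rewritten into the right one.
-- Apart from (8)–(10) at the root, every step is one of (1)–(7) extended from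
-- generators to whole shifted copies of G: conjugation by Σ_ε or A_ε acts on
-- sh₀ g, sh₁₀ g, sh₁₁ g as (2)–(7) prescribe, and sh₀ g commutes with sh₁ h by (1).
module Submission where

open import Defs
open import Data.Bool using (true; false)
open import Data.List using (List; []; _∷_; _++_; foldl)
open import Data.List.Properties using (++-assoc)
open import Data.Product using (_×_; _,_)
open import Data.Sum using (inj₁; inj₂)
open import Data.Vec using (toList)
open import Data.Vec.Recursive using (_^_; toVec)
open import Relation.Binary.PropositionalEquality using (refl)
open import Relation.Binary.Bundles using (Setoid)
open import Algebra.Bundles using (Group)
import Algebra.Morphism.Definitions as MorphismDefinitions
import Algebra.Properties.Group as GroupProperties
import Relation.Binary.Reasoning.Setoid as SetoidReasoning

G : Group _ _
G = record
  { Carrier = Term ; _≈_ = _≈_ ; _∙_ = _·_ ; ε = one ; _⁻¹ = _⁻¹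
  ; isGroup = record
    { isMonoid = record
      { isSemigroup = record
        { isMagma = record
          { isEquivalence = record { refl = ≈-refl ; sym = ≈-sym ; trans = ≈-trans }
          ; ∙-cong = ·-cong }
        ; assoc = assoc }
      ; identity = idˡ , idʳ }
    ; inverse = invˡ , invʳ
    ; ⁻¹-cong = ⁻¹-cong } }

open Group G using (setoid; ∙-congˡ; ∙-congʳ)
open GroupProperties G using (⁻¹-involutive; ⁻¹-anti-homo-∙; ε⁻¹≈ε; \\-leftDividesʳ; //-rightDividesʳ)
open MorphismDefinitions Term Term _≈_ using (Homomorphic₀; Homomorphic₁; Homomorphic₂)
module ≈-Reasoning = SetoidReasoning setoid

-- φ need not respect ≈ (that would require checking every defining relation);
-- intertwine below only recurses on the syntax of terms.
record IsEndo (φ : Term → Term) : Set where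
  field
    ·-homo   : Homomorphic₂ φ _·_ _·_
    one-homo : Homomorphic₀ φ one one
    ⁻¹-homo  : Homomorphic₁ φ _⁻¹ _⁻¹

sh-isEndo : ∀ γ → IsEndo (sh γ)
sh-isEndo _ = record { ·-homo = λ _ _ → ≈-refl ; one-homo = ≈-refl ; ⁻¹-homo = λ _ → ≈-refl }

sh-sh-isEndo : ∀ γ δ → IsEndo (λ g → sh γ (sh δ g))
sh-sh-isEndo _ _ = record { ·-homo = λ _ _ → ≈-refl ; one-homo = ≈-refl ; ⁻¹-homo = λ _ → ≈-refl }

⁻¹-intertwine : ∀ {a b c} → a · c ≈ c · b → a ⁻¹ · c ≈ c · b ⁻¹
⁻¹-intertwine {a} {b} {c} ac≈cb = begin
  a ⁻¹ · c                ≈⟨ ∙-congˡ (//-rightDividesʳ b c) ⟨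
  a ⁻¹ · (c · b · b ⁻¹)   ≈⟨ ∙-congˡ (∙-congʳ ac≈cb) ⟨
  a ⁻¹ · (a · c · b ⁻¹)   ≈⟨ ∙-congˡ (assoc a c (b ⁻¹)) ⟩
  a ⁻¹ · (a · (c · b ⁻¹)) ≈⟨ \\-leftDividesʳ a (c · b ⁻¹) ⟩
  c · b ⁻¹                ∎
  where open ≈-Reasoning

intertwine : ∀ {φ ψ} → IsEndo φ → IsEndo ψ → ∀ c →
  (∀ X α → φ (gen X α) · c ≈ c · ψ (gen X α)) → ∀ g → φ g · c ≈ c · ψ g
intertwine {φ} {ψ} φ-endo ψ-endo c on-gen = go
  where
  open ≈-Reasoning
  module φ = IsEndo φ-endo
  module ψ = IsEndo ψ-endo

  go : ∀ g → φ g · c ≈ c · ψ g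
  go (gen X α) = on-gen X α
  go one = begin
    φ one · c ≈⟨ ∙-congʳ φ.one-homo ⟩
    one · c   ≈⟨ idˡ c ⟩
    c         ≈⟨ idʳ c ⟨
    c · one   ≈⟨ ∙-congˡ ψ.one-homo ⟨
    c · ψ one ∎
  go (g · h) = begin
    φ (g · h) · c     ≈⟨ ∙-congʳ (φ.·-homo g h) ⟩
    φ g · φ h · c     ≈⟨ assoc _ _ _ ⟩
    φ g · (φ h · c)   ≈⟨ ∙-congˡ (go h) ⟩
    φ g · (c · ψ h)   ≈⟨ assoc _ _ _ ⟨
    φ g · c · ψ h     ≈⟨ ∙-congʳ (go g) ⟩
    c · ψ g · ψ h     ≈⟨ assoc _ _ _ ⟩
    c · (ψ g · ψ h)   ≈⟨ ∙-congˡ (ψ.·-homo g h) ⟨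
    c · ψ (g · h)     ∎
  go (g ⁻¹) = begin
    φ (g ⁻¹) · c  ≈⟨ ∙-congʳ (φ.⁻¹-homo g) ⟩
    φ g ⁻¹ · c    ≈⟨ ⁻¹-intertwine (go g) ⟩
    c · ψ g ⁻¹    ≈⟨ ∙-congˡ (ψ.⁻¹-homo g) ⟨
    c · ψ (g ⁻¹)  ∎

incomparable-++ : ∀ {α β} δ δ′ → Incomparable α β → Incomparable (α ++ δ) (β ++ δ′)
incomparable-++ δ δ′ (inj₁ (γ , η , η′ , refl , refl)) =
  inj₁ (γ , η ++ δ , η′ ++ δ′ , ++-assoc γ (false ∷ η) δ , ++-assoc γ (true ∷ η′) δ′)
incomparable-++ δ δ′ (inj₂ (γ , η , η′ , refl , refl)) =
  inj₂ (γ , η ++ δ , η′ ++ δ′ , ++-assoc γ (true ∷ η) δ , ++-assoc γ (false ∷ η′) δ′)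

sh-commute : ∀ {α β} → Incomparable α β → ∀ g h → sh α g · sh β h ≈ sh β h · sh α g
sh-commute {α} {β} α⊥β g h = ≈-sym (intertwine (sh-isEndo β) (sh-isEndo β) (sh α g) sh-β-gen h)
  where
  sh-β-gen : ∀ Y δ′ → sh β (gen Y δ′) · sh α g ≈ sh α g · sh β (gen Y δ′)
  sh-β-gen Y δ′ = ≈-sym (intertwine (sh-isEndo α) (sh-isEndo α) (gen Y (β ++ δ′))
    (λ X δ → r1 X Y _ _ (incomparable-++ δ δ′ α⊥β)) g)

sh₀-sh₁-commute : ∀ α β g h → sh (false ∷ α) g · sh (true ∷ β) h ≈ sh (true ∷ β) h · sh (false ∷ α) g
sh₀-sh₁-commute α β = sh-commute (inj₁ ([] , α , β , refl , refl))

sh₀ sh₁ sh₀₀ sh₀₁ sh₁₀ sh₁₁ : Term → Term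
sh₀ = sh (false ∷ [])
sh₁ = sh (true ∷ [])
sh₀₀ = sh (false ∷ false ∷ [])
sh₀₁ = sh (false ∷ true ∷ [])
-- Composites, not sh (true ∷ false ∷ []) etc.: this is how they arise from nested
-- ⋆ and ∘, and the two differ definitionally on a variable argument.
sh₁₀ g = sh₁ (sh₀ g)
sh₁₁ g = sh₁ (sh₁ g)

Σε Aε Σ₀ Σ₁ A₀ A₁ : Term
Σε = Σ′ ε
Aε = A′ ε
Σ₀ = Σ′ (false ∷ [])
Σ₁ = Σ′ (true ∷ [])
A₀ = A′ (false ∷ [])
A₁ = A′ (true ∷ [])

gen₀-sh₁-commute : ∀ X h → gen X (false ∷ []) · sh₁ h ≈ sh₁ h · gen X (false ∷ [])
gen₀-sh₁-commute X = sh₀-sh₁-commute [] [] (gen X ε)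

duplicate : Term → Term
duplicate g = sh₀₀ g · sh₁₀ g

duplicate-isEndo : IsEndo duplicate
duplicate-isEndo = record { ·-homo = ·-homo ; one-homo = idˡ one ; ⁻¹-homo = ⁻¹-homo }
  where
  open ≈-Reasoning

  sh₀₀-sh₁₀-commute : ∀ g h → sh₀₀ g · sh₁₀ h ≈ sh₁₀ h · sh₀₀ g
  sh₀₀-sh₁₀-commute g h = sh₀-sh₁-commute (false ∷ []) [] g (sh₀ h)

  ·-homo : ∀ g h → duplicate (g · h) ≈ duplicate g · duplicate h
  ·-homo g h = begin
    sh₀₀ g · sh₀₀ h · (sh₁₀ g · sh₁₀ h)   ≈⟨ assoc _ _ _ ⟩
    sh₀₀ g · (sh₀₀ h · (sh₁₀ g · sh₁₀ h)) ≈⟨ ∙-congˡ (assoc _ _ _) ⟨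
    sh₀₀ g · (sh₀₀ h · sh₁₀ g · sh₁₀ h)   ≈⟨ ∙-congˡ (∙-congʳ (sh₀₀-sh₁₀-commute h g)) ⟩
    sh₀₀ g · (sh₁₀ g · sh₀₀ h · sh₁₀ h)   ≈⟨ ∙-congˡ (assoc _ _ _) ⟩
    sh₀₀ g · (sh₁₀ g · (sh₀₀ h · sh₁₀ h)) ≈⟨ assoc _ _ _ ⟨
    sh₀₀ g · sh₁₀ g · (sh₀₀ h · sh₁₀ h)   ∎

  ⁻¹-homo : ∀ g → duplicate (g ⁻¹) ≈ duplicate g ⁻¹
  ⁻¹-homo g = begin
    sh₀₀ g ⁻¹ · sh₁₀ g ⁻¹    ≈⟨ ⁻¹-anti-homo-∙ (sh₁₀ g) (sh₀₀ g) ⟨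
    (sh₁₀ g · sh₀₀ g) ⁻¹     ≈⟨ ⁻¹-cong (sh₀₀-sh₁₀-commute g g) ⟨
    (sh₀₀ g · sh₁₀ g) ⁻¹     ∎

sh₀-Σ : ∀ g → sh₀ g · Σε ≈ Σε · sh₀₀ g · sh₁₀ g
sh₀-Σ g = ≈-trans
  (intertwine (sh-isEndo _) duplicate-isEndo Σε (λ X α → ≈-trans (r2 X ε α) (assoc _ _ _)) g)
  (≈-sym (assoc _ _ _))

sh₁₀-Σ : ∀ g → sh₁₀ g · Σε ≈ Σε · sh₀₁ g
sh₁₀-Σ = intertwine (sh-sh-isEndo _ _) (sh-isEndo _) Σε (λ X → r3 X ε)

sh₁₁-Σ : ∀ g → sh₁₁ g · Σε ≈ Σε · sh₁₁ g
sh₁₁-Σ = intertwine (sh-sh-isEndo _ _) (sh-sh-isEndo _ _) Σε (λ X → r4 X ε)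

sh₀-A : ∀ g → sh₀ g · Aε ≈ Aε · sh₀₀ g
sh₀-A = intertwine (sh-isEndo _) (sh-isEndo _) Aε (λ X → r5 X ε)

sh₁₀-A : ∀ g → sh₁₀ g · Aε ≈ Aε · sh₀₁ g
sh₁₀-A = intertwine (sh-sh-isEndo _ _) (sh-isEndo _) Aε (λ X → r6 X ε)

sh₁₁-A : ∀ g → sh₁₁ g · Aε ≈ Aε · sh₁ g
sh₁₁-A = intertwine (sh-sh-isEndo _ _) (sh-isEndo _) Aε (λ X → r7 X ε)

infix 9 +_ -_
data Letter : Set where
  +_ -_ : Term → Letter

Word : Set
Word = List Letter

⟦_⟧ˡ : Letter → Term
⟦ + t ⟧ˡ = t
⟦ - t ⟧ˡ = t ⁻¹

⟦_⟧ʷ : Word → Term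
⟦ [] ⟧ʷ = one
⟦ a ∷ w ⟧ʷ = ⟦ a ⟧ˡ · ⟦ w ⟧ʷ

-- Left-associated, the shape in which the relations and the lemmas above are
-- stated, so that they apply verbatim to a factor of a word.
⟦_⟧ʷˡ : Word → Term
⟦ [] ⟧ʷˡ = one
⟦ a ∷ w ⟧ʷˡ = foldl (λ t b → t · ⟦ b ⟧ˡ) ⟦ a ⟧ˡ w

infix 4 _≋_
record _≋_ (u v : Word) : Set where
  constructor ≋-intro
  field ≋-elim : ⟦ u ⟧ʷ ≈ ⟦ v ⟧ʷ

≋-setoid : Setoid _ _
≋-setoid = record
  { Carrier = Word ; _≈_ = _≋_
  ; isEquivalence = record
    { refl = ≋-intro ≈-refl
    ; sym = λ (≋-intro p) → ≋-intro (≈-sym p)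
    ; trans = λ (≋-intro p) (≋-intro q) → ≋-intro (≈-trans p q) } }

⟦++⟧ʷ : ∀ u v → ⟦ u ++ v ⟧ʷ ≈ ⟦ u ⟧ʷ · ⟦ v ⟧ʷ
⟦++⟧ʷ [] v = ≈-sym (idˡ _)
⟦++⟧ʷ (a ∷ u) v = ≈-trans (∙-congˡ (⟦++⟧ʷ u v)) (≈-sym (assoc _ _ _))

foldl-· : ∀ t w → foldl (λ t b → t · ⟦ b ⟧ˡ) t w ≈ t · ⟦ w ⟧ʷ
foldl-· t [] = ≈-sym (idʳ t)
foldl-· t (b ∷ w) = ≈-trans (foldl-· (t · ⟦ b ⟧ˡ) w) (assoc _ _ _)

⟦⟧ʷˡ≈⟦⟧ʷ : ∀ w → ⟦ w ⟧ʷˡ ≈ ⟦ w ⟧ʷ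
⟦⟧ʷˡ≈⟦⟧ʷ [] = ≈-refl
⟦⟧ʷˡ≈⟦⟧ʷ (a ∷ w) = foldl-· ⟦ a ⟧ˡ w

-- Factors are tuples rather than lists so that, given their length, Agda reads
-- them off the surrounding word by unification (tuples have η).
word : ∀ n → Letter ^ n → Word
word n ls = toList (toVec n ls)

at : ∀ n m k {pre : Letter ^ n} {l : Letter ^ m} {r : Letter ^ k} {post : Word} →
     ⟦ word m l ⟧ʷˡ ≈ ⟦ word k r ⟧ʷˡ →
     word n pre ++ word m l ++ post ≋ word n pre ++ word k r ++ post
at n m k {pre} {l} {r} {post} l≈r = ≋-intro (begin
  ⟦ word n pre ++ word m l ++ post ⟧ʷ            ≈⟨ ⟦++⟧ʷ (word n pre) _ ⟩
  ⟦ word n pre ⟧ʷ · ⟦ word m l ++ post ⟧ʷ        ≈⟨ ∙-congˡ (⟦++⟧ʷ (word m l) post) ⟩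
  ⟦ word n pre ⟧ʷ · (⟦ word m l ⟧ʷ · ⟦ post ⟧ʷ)  ≈⟨ ∙-congˡ (∙-congʳ l≈r′) ⟩
  ⟦ word n pre ⟧ʷ · (⟦ word k r ⟧ʷ · ⟦ post ⟧ʷ)  ≈⟨ ∙-congˡ (⟦++⟧ʷ (word k r) post) ⟨
  ⟦ word n pre ⟧ʷ · ⟦ word k r ++ post ⟧ʷ        ≈⟨ ⟦++⟧ʷ (word n pre) _ ⟨
  ⟦ word n pre ++ word k r ++ post ⟧ʷ            ∎)
  where
  open ≈-Reasoning
  l≈r′ : ⟦ word m l ⟧ʷ ≈ ⟦ word k r ⟧ʷ
  l≈r′ = ≈-trans (≈-sym (⟦⟧ʷˡ≈⟦⟧ʷ (word m l))) (≈-trans l≈r (⟦⟧ʷˡ≈⟦⟧ʷ (word k r)))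

module ≋-Reasoning = SetoidReasoning ≋-setoid

infix 10 _⁻¹ˡ _⁻¹ʷ
_⁻¹ˡ : Letter → Letter
(+ t) ⁻¹ˡ = - t
(- t) ⁻¹ˡ = + t

_⁻¹ʷ : Word → Word
[] ⁻¹ʷ = []
(a ∷ w) ⁻¹ʷ = w ⁻¹ʷ ++ a ⁻¹ˡ ∷ []

⟦⁻¹ˡ⟧ : ∀ a → ⟦ a ⁻¹ˡ ⟧ˡ ≈ ⟦ a ⟧ˡ ⁻¹
⟦⁻¹ˡ⟧ (+ t) = ≈-refl
⟦⁻¹ˡ⟧ (- t) = ≈-sym (⁻¹-involutive t)

⟦⁻¹ʷ⟧ : ∀ w → ⟦ w ⁻¹ʷ ⟧ʷ ≈ ⟦ w ⟧ʷ ⁻¹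
⟦⁻¹ʷ⟧ [] = ≈-sym ε⁻¹≈ε
⟦⁻¹ʷ⟧ (a ∷ w) = begin
  ⟦ w ⁻¹ʷ ++ a ⁻¹ˡ ∷ [] ⟧ʷ         ≈⟨ ⟦++⟧ʷ (w ⁻¹ʷ) _ ⟩
  ⟦ w ⁻¹ʷ ⟧ʷ · (⟦ a ⁻¹ˡ ⟧ˡ · one)  ≈⟨ ·-cong (⟦⁻¹ʷ⟧ w) (≈-trans (idʳ _) (⟦⁻¹ˡ⟧ a)) ⟩
  ⟦ w ⟧ʷ ⁻¹ · ⟦ a ⟧ˡ ⁻¹             ≈⟨ ⁻¹-anti-homo-∙ ⟦ a ⟧ˡ ⟦ w ⟧ʷ ⟨
  (⟦ a ⟧ˡ · ⟦ w ⟧ʷ) ⁻¹              ∎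
  where open ≈-Reasoning

-- Group expressions whose atoms are arbitrary terms: unlike a Term, an
-- expression built from variables x, y, z can be flattened into a word.
infixl 6 _⊙_ _⋆ᵉ_ _∘ᵉ_
data Expr : Set where
  atom : Term → Expr
  _⊙_  : Expr → Expr → Expr
  inv  : Expr → Expr

⟦_⟧ᵉ : Expr → Term
⟦ atom t ⟧ᵉ = t
⟦ e ⊙ f ⟧ᵉ = ⟦ e ⟧ᵉ · ⟦ f ⟧ᵉ
⟦ inv e ⟧ᵉ = ⟦ e ⟧ᵉ ⁻¹

shᵉ : Address → Expr → Expr
shᵉ γ (atom t) = atom (sh γ t)
shᵉ γ (e ⊙ f) = shᵉ γ e ⊙ shᵉ γ f
shᵉ γ (inv e) = inv (shᵉ γ e)

_⋆ᵉ_ _∘ᵉ_ : Expr → Expr → Expr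
e ⋆ᵉ f = e ⊙ shᵉ (true ∷ []) f ⊙ atom Σε ⊙ inv (shᵉ (true ∷ []) e)
e ∘ᵉ f = e ⊙ shᵉ (true ∷ []) f ⊙ atom Aε

flatten : Expr → Word
flatten (atom t) = + t ∷ []
flatten (e ⊙ f) = flatten e ++ flatten f
flatten (inv e) = flatten e ⁻¹ʷ

flatten-sound : ∀ e → ⟦ e ⟧ᵉ ≈ ⟦ flatten e ⟧ʷ
flatten-sound (atom t) = ≈-sym (idʳ t)
flatten-sound (e ⊙ f) = ≈-trans (·-cong (flatten-sound e) (flatten-sound f)) (≈-sym (⟦++⟧ʷ (flatten e) _))
flatten-sound (inv e) = ≈-trans (⁻¹-cong (flatten-sound e)) (≈-sym (⟦⁻¹ʷ⟧ (flatten e)))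

by-words : ∀ e f → flatten e ≋ flatten f → ⟦ e ⟧ᵉ ≈ ⟦ f ⟧ᵉ
by-words e f (≋-intro p) = ≈-trans (flatten-sound e) (≈-trans p (≈-sym (flatten-sound f)))

module Identities (x y z : Term) where
  open ≋-Reasoning

  x₁ y₁ z₁ x₁₁ y₁₁ z₁₁ z₀ z₀₀ z₀₁ z₁₀ : Term
  x₁ = sh₁ x
  y₁ = sh₁ y
  z₁ = sh₁ z
  x₁₁ = sh₁₁ x
  y₁₁ = sh₁₁ y
  z₁₁ = sh₁₁ z
  z₀ = sh₀ z
  z₀₀ = sh₀₀ z
  z₀₁ = sh₀₁ z
  z₁₀ = sh₁₀ z

  X Y Z : Expr
  X = atom x
  Y = atom y
  Z = atom z

  ⋆-distribˡ-⋆ : (x ⋆ y) ⋆ (x ⋆ z) ≈ (x ⋆ (y ⋆ z)) · Σ₀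
  ⋆-distribˡ-⋆ = by-words ((X ⋆ᵉ Y) ⋆ᵉ (X ⋆ᵉ Z)) (X ⋆ᵉ (Y ⋆ᵉ Z) ⊙ atom Σ₀) (begin
    + x ∷ + y₁ ∷ + Σε ∷ - x₁ ∷ + x₁ ∷ + z₁₁ ∷ + Σ₁ ∷ - x₁₁ ∷ + Σε ∷ + x₁₁ ∷ - Σ₁ ∷ - y₁₁ ∷ - x₁ ∷ []
      ≈⟨ at 3 2 0 (invˡ x₁) ⟩
    + x ∷ + y₁ ∷ + Σε ∷ + z₁₁ ∷ + Σ₁ ∷ - x₁₁ ∷ + Σε ∷ + x₁₁ ∷ - Σ₁ ∷ - y₁₁ ∷ - x₁ ∷ []
      ≈⟨ at 5 2 2 (sh₁₁-Σ (x ⁻¹)) ⟩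
    + x ∷ + y₁ ∷ + Σε ∷ + z₁₁ ∷ + Σ₁ ∷ + Σε ∷ - x₁₁ ∷ + x₁₁ ∷ - Σ₁ ∷ - y₁₁ ∷ - x₁ ∷ []
      ≈⟨ at 6 2 0 (invˡ x₁₁) ⟩
    + x ∷ + y₁ ∷ + Σε ∷ + z₁₁ ∷ + Σ₁ ∷ + Σε ∷ - Σ₁ ∷ - y₁₁ ∷ - x₁ ∷ []
      ≈⟨ at 2 2 2 (≈-sym (sh₁₁-Σ z)) ⟩
    + x ∷ + y₁ ∷ + z₁₁ ∷ + Σε ∷ + Σ₁ ∷ + Σε ∷ - Σ₁ ∷ - y₁₁ ∷ - x₁ ∷ []
      ≈⟨ at 3 3 4 (r8 ε) ⟩
    + x ∷ + y₁ ∷ + z₁₁ ∷ + Σ₁ ∷ + Σε ∷ + Σ₁ ∷ + Σ₀ ∷ - Σ₁ ∷ - y₁₁ ∷ - x₁ ∷ []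
      ≈⟨ at 6 2 2 (gen₀-sh₁-commute S (Σε ⁻¹)) ⟩
    + x ∷ + y₁ ∷ + z₁₁ ∷ + Σ₁ ∷ + Σε ∷ + Σ₁ ∷ - Σ₁ ∷ + Σ₀ ∷ - y₁₁ ∷ - x₁ ∷ []
      ≈⟨ at 5 2 0 (invʳ Σ₁) ⟩
    + x ∷ + y₁ ∷ + z₁₁ ∷ + Σ₁ ∷ + Σε ∷ + Σ₀ ∷ - y₁₁ ∷ - x₁ ∷ []
      ≈⟨ at 5 2 2 (gen₀-sh₁-commute S (y₁ ⁻¹)) ⟩
    + x ∷ + y₁ ∷ + z₁₁ ∷ + Σ₁ ∷ + Σε ∷ - y₁₁ ∷ + Σ₀ ∷ - x₁ ∷ []
      ≈⟨ at 4 2 2 (≈-sym (sh₁₁-Σ (y ⁻¹))) ⟩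
    + x ∷ + y₁ ∷ + z₁₁ ∷ + Σ₁ ∷ - y₁₁ ∷ + Σε ∷ + Σ₀ ∷ - x₁ ∷ []
      ≈⟨ at 6 2 2 (gen₀-sh₁-commute S (x ⁻¹)) ⟩
    + x ∷ + y₁ ∷ + z₁₁ ∷ + Σ₁ ∷ - y₁₁ ∷ + Σε ∷ - x₁ ∷ + Σ₀ ∷ []
      ∎)

  ⋆-distribˡ-∘ : (x ⋆ y) ∘ (x ⋆ z) ≈ (x ⋆ (y ∘ z)) · Σ₀
  ⋆-distribˡ-∘ = by-words ((X ⋆ᵉ Y) ∘ᵉ (X ⋆ᵉ Z)) (X ⋆ᵉ (Y ∘ᵉ Z) ⊙ atom Σ₀) (begin
    + x ∷ + y₁ ∷ + Σε ∷ - x₁ ∷ + x₁ ∷ + z₁₁ ∷ + Σ₁ ∷ - x₁₁ ∷ + Aε ∷ []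
      ≈⟨ at 3 2 0 (invˡ x₁) ⟩
    + x ∷ + y₁ ∷ + Σε ∷ + z₁₁ ∷ + Σ₁ ∷ - x₁₁ ∷ + Aε ∷ []
      ≈⟨ at 5 2 2 (sh₁₁-A (x ⁻¹)) ⟩
    + x ∷ + y₁ ∷ + Σε ∷ + z₁₁ ∷ + Σ₁ ∷ + Aε ∷ - x₁ ∷ []
      ≈⟨ at 2 2 2 (≈-sym (sh₁₁-Σ z)) ⟩
    + x ∷ + y₁ ∷ + z₁₁ ∷ + Σε ∷ + Σ₁ ∷ + Aε ∷ - x₁ ∷ []
      ≈⟨ at 3 3 3 (r9 ε) ⟩
    + x ∷ + y₁ ∷ + z₁₁ ∷ + A₁ ∷ + Σε ∷ + Σ₀ ∷ - x₁ ∷ []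
      ≈⟨ at 5 2 2 (gen₀-sh₁-commute S (x ⁻¹)) ⟩
    + x ∷ + y₁ ∷ + z₁₁ ∷ + A₁ ∷ + Σε ∷ - x₁ ∷ + Σ₀ ∷ []
      ∎)

  ∘-⋆-assoc : (x ∘ y) ⋆ z ≈ (x ⋆ (y ⋆ z)) · A₀
  ∘-⋆-assoc = by-words ((X ∘ᵉ Y) ⋆ᵉ Z) (X ⋆ᵉ (Y ⋆ᵉ Z) ⊙ atom A₀) (begin
    + x ∷ + y₁ ∷ + Aε ∷ + z₁ ∷ + Σε ∷ - A₁ ∷ - y₁₁ ∷ - x₁ ∷ []
      ≈⟨ at 2 2 2 (≈-sym (sh₁₁-A z)) ⟩
    + x ∷ + y₁ ∷ + z₁₁ ∷ + Aε ∷ + Σε ∷ - A₁ ∷ - y₁₁ ∷ - x₁ ∷ []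
      ≈⟨ at 3 2 4 (r10 ε) ⟩
    + x ∷ + y₁ ∷ + z₁₁ ∷ + Σ₁ ∷ + Σε ∷ + A₁ ∷ + A₀ ∷ - A₁ ∷ - y₁₁ ∷ - x₁ ∷ []
      ≈⟨ at 6 2 2 (gen₀-sh₁-commute A (Aε ⁻¹)) ⟩
    + x ∷ + y₁ ∷ + z₁₁ ∷ + Σ₁ ∷ + Σε ∷ + A₁ ∷ - A₁ ∷ + A₀ ∷ - y₁₁ ∷ - x₁ ∷ []
      ≈⟨ at 5 2 0 (invʳ A₁) ⟩
    + x ∷ + y₁ ∷ + z₁₁ ∷ + Σ₁ ∷ + Σε ∷ + A₀ ∷ - y₁₁ ∷ - x₁ ∷ []
      ≈⟨ at 5 2 2 (gen₀-sh₁-commute A (y₁ ⁻¹)) ⟩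
    + x ∷ + y₁ ∷ + z₁₁ ∷ + Σ₁ ∷ + Σε ∷ - y₁₁ ∷ + A₀ ∷ - x₁ ∷ []
      ≈⟨ at 4 2 2 (≈-sym (sh₁₁-Σ (y ⁻¹))) ⟩
    + x ∷ + y₁ ∷ + z₁₁ ∷ + Σ₁ ∷ - y₁₁ ∷ + Σε ∷ + A₀ ∷ - x₁ ∷ []
      ≈⟨ at 6 2 2 (gen₀-sh₁-commute A (x ⁻¹)) ⟩
    + x ∷ + y₁ ∷ + z₁₁ ∷ + Σ₁ ∷ - y₁₁ ∷ + Σε ∷ - x₁ ∷ + A₀ ∷ []
      ∎)

  ⋆-sh₀ˡ : (x · sh₀ z) ⋆ y ≈ (x ⋆ y) · sh₀₀ z
  ⋆-sh₀ˡ = by-words ((X ⊙ atom z₀) ⋆ᵉ Y) (X ⋆ᵉ Y ⊙ atom z₀₀) (begin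
    + x ∷ + z₀ ∷ + y₁ ∷ + Σε ∷ - z₁₀ ∷ - x₁ ∷ []
      ≈⟨ at 1 2 2 (sh₀-sh₁-commute [] [] z y) ⟩
    + x ∷ + y₁ ∷ + z₀ ∷ + Σε ∷ - z₁₀ ∷ - x₁ ∷ []
      ≈⟨ at 2 2 3 (sh₀-Σ z) ⟩
    + x ∷ + y₁ ∷ + Σε ∷ + z₀₀ ∷ + z₁₀ ∷ - z₁₀ ∷ - x₁ ∷ []
      ≈⟨ at 4 2 0 (invʳ z₁₀) ⟩
    + x ∷ + y₁ ∷ + Σε ∷ + z₀₀ ∷ - x₁ ∷ []
      ≈⟨ at 3 2 2 (sh₀-sh₁-commute (false ∷ []) [] z (x ⁻¹)) ⟩
    + x ∷ + y₁ ∷ + Σε ∷ - x₁ ∷ + z₀₀ ∷ []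
      ∎)

  ∘-sh₀ˡ : (x · sh₀ z) ∘ y ≈ (x ∘ y) · sh₀₀ z
  ∘-sh₀ˡ = by-words ((X ⊙ atom z₀) ∘ᵉ Y) (X ∘ᵉ Y ⊙ atom z₀₀) (begin
    + x ∷ + z₀ ∷ + y₁ ∷ + Aε ∷ [] ≈⟨ at 1 2 2 (sh₀-sh₁-commute [] [] z y) ⟩
    + x ∷ + y₁ ∷ + z₀ ∷ + Aε ∷ [] ≈⟨ at 2 2 2 (sh₀-A z) ⟩
    + x ∷ + y₁ ∷ + Aε ∷ + z₀₀ ∷ [] ∎)

  ⋆-sh₀ʳ : x ⋆ (y · sh₀ z) ≈ (x ⋆ y) · sh₀₁ z
  ⋆-sh₀ʳ = by-words (X ⋆ᵉ (Y ⊙ atom z₀)) (X ⋆ᵉ Y ⊙ atom z₀₁) (begin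
    + x ∷ + y₁ ∷ + z₁₀ ∷ + Σε ∷ - x₁ ∷ [] ≈⟨ at 2 2 2 (sh₁₀-Σ z) ⟩
    + x ∷ + y₁ ∷ + Σε ∷ + z₀₁ ∷ - x₁ ∷ [] ≈⟨ at 3 2 2 (sh₀-sh₁-commute (true ∷ []) [] z (x ⁻¹)) ⟩
    + x ∷ + y₁ ∷ + Σε ∷ - x₁ ∷ + z₀₁ ∷ [] ∎)

  ∘-sh₀ʳ : x ∘ (y · sh₀ z) ≈ (x ∘ y) · sh₀₁ z
  ∘-sh₀ʳ = by-words (X ∘ᵉ (Y ⊙ atom z₀)) (X ∘ᵉ Y ⊙ atom z₀₁) (begin
    + x ∷ + y₁ ∷ + z₁₀ ∷ + Aε ∷ [] ≈⟨ at 2 2 2 (sh₁₀-A z) ⟩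
    + x ∷ + y₁ ∷ + Aε ∷ + z₀₁ ∷ [] ∎)

lemma4p3 : ∀ (x y z : Term) (□ : Op) →
    ((x ⋆ y) ⟨ □ ⟩ (x ⋆ z) ≈ (x ⋆ (y ⟨ □ ⟩ z)) · Σ′ (false ∷ []))
    × ((x ∘ y) ⋆ z ≈ (x ⋆ (y ⋆ z)) · A′ (false ∷ []))
    × ((x · sh (false ∷ []) z) ⟨ □ ⟩ y ≈ (x ⟨ □ ⟩ y) · sh (false ∷ false ∷ []) z)
    × (x ⟨ □ ⟩ (y · sh (false ∷ []) z) ≈ (x ⟨ □ ⟩ y) · sh (false ∷ true ∷ []) z)
lemma4p3 x y z star = ⋆-distribˡ-⋆ , ∘-⋆-assoc , ⋆-sh₀ˡ , ⋆-sh₀ʳ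
  where open Identities x y z
lemma4p3 x y z circ = ⋆-distribˡ-∘ , ∘-⋆-assoc , ∘-sh₀ˡ , ∘-sh₀ʳ
  where open Identities x y z
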